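{- Let $A$ be the set of active intervals of a finite collection of intervals, ordered by $\prec$. For every $I_i\in A$, the set $\{I_{i'}\in A : \textsc{LC-decr}(I_{i'})=I_i\}$ forms a contiguous range of $A$ with respect to $\prec$.
   Context: Intervals are pairs $(s,f)$ of reals with $s<f$, with pairwise distinct endpoints. An interval $(s_i,f_i)$ of a collection $C$ is active if there is no other $(s_{i'},f_{i'})\in C$ with $s_i\le s_{i'}\le f_{i'}\le f_i$. On a set of active intervals, $(s_i,f_i)\prec(s_{i'},f_{i'})$ iff $s_i<s_{i'}$ (equivalently $f_i<f_{i'}$). For an interval $I=(s,f)$, $\textsc{LC-decr}(I)$ is the interval of $A$ with the smallest end among those intervals of $A$ starting at or after $f$ (the next greedy choice in $A$ after $I$), or $\perp$ if there is none. -}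

module Defs where

open import Level using (Level)
open import Data.Nat using (ℕ)
open import Data.Fin using (Fin)
open import Data.Sum using (_⊎_; inj₁; inj₂)
open import Data.Product using (_×_; _,_; proj₁; proj₂)
open import Relation.Binary.Bundles using (StrictTotalOrder)
open import Relation.Binary.PropositionalEquality using (_≡_; _≢_)
open import Relation.Nullary using (¬_)

module Intervals {a ℓ₁ ℓ₂ : Level} (O : StrictTotalOrder a ℓ₁ ℓ₂) where
  open StrictTotalOrder O renaming (Carrier to R)

  _≤ᵒ_ : R → R → Set _
  x ≤ᵒ y = (x < y) ⊎ (x ≈ y)

  Collection : ℕ → Set a
  Collection n = Fin n → R × R

  module _ {n : ℕ} (C : Collection n) where
    start end : Fin n → R
    start i = proj₁ (C i)
    end   i = proj₂ (C i)

    WellFormed : Set _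
    WellFormed = ∀ i → start i < end i

    endpoint : Fin n ⊎ Fin n → R
    endpoint (inj₁ i) = start i
    endpoint (inj₂ i) = end i

    DistinctEndpoints : Set _
    DistinctEndpoints = ∀ p q → endpoint p ≈ endpoint q → p ≡ q

    Active : Fin n → Set _
    Active i = ∀ j → j ≢ i →
      ¬ ((start i ≤ᵒ start j) × (start j ≤ᵒ end j) × (end j ≤ᵒ end i))

    _≺_ : Fin n → Fin n → Set _
    i ≺ j = start i < start j

    -- LCdecr i k : "LC-decr(I_i) = I_k", i.e. I_k is the interval of A with
    -- the smallest end among the intervals of A starting at or after end i
    LCdecr : Fin n → Fin n → Set _
    LCdecr i k =
      Active k × (end i ≤ᵒ start k) ×
      (∀ k' → Active k' → end i ≤ᵒ start k' → end k ≤ᵒ end k')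

-- LC-decr(I) depends only on the end of I, and monotonically: a later end only shrinks the
-- set of candidates. So if I_x and I_z both map to I_i and end x ≤ end y ≤ end z, then I_i
-- is still a candidate for I_y and still beats every candidate of I_y. On active intervals
-- ≺ orders the ends as it orders the starts, since otherwise one interval is nested in the other.
module Submission where

open import Defs
open import Level using (Level)
open import Data.Nat using (ℕ)
open import Data.Empty using (⊥-elim)
open import Data.Sum using (inj₁; inj₂)
open import Data.Product using (_,_)
open import Relation.Binary.Bundles using (StrictTotalOrder)
open import Relation.Binary.Definitions using (tri<; tri≈; tri>)
open import Relation.Binary.PropositionalEquality using (_≢_; refl)
open import Relation.Nullary using (¬_)

module LCdecrProperties {a ℓ₁ ℓ₂ : Level} (O : StrictTotalOrder a ℓ₁ ℓ₂) {n : ℕ}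
    (C : Intervals.Collection O n) where
  open StrictTotalOrder O
  open Intervals O
  open import Relation.Binary.Construct.StrictToNonStrict _≈_ _<_ as NonStrict using ()

  ≤ᵒ-trans : ∀ {p q r} → p ≤ᵒ q → q ≤ᵒ r → p ≤ᵒ r
  ≤ᵒ-trans = NonStrict.trans Eq.isEquivalence <-resp-≈ trans

  LCdecr-between-ends : ∀ {x y z i} → LCdecr C x i → LCdecr C z i →
    end C x ≤ᵒ end C y → end C y ≤ᵒ end C z → LCdecr C y i
  LCdecr-between-ends (ai , _ , x-min) (_ , z≤i , _) x≤y y≤z =
    ai , ≤ᵒ-trans y≤z z≤i , λ k ak y≤k → x-min k ak (≤ᵒ-trans x≤y y≤k)

  ≺⇒≢ : ∀ {y z} → _≺_ C y z → z ≢ y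
  ≺⇒≢ y≺z refl = irrefl Eq.refl y≺z

  active-≺⇒¬end≤ : WellFormed C → ∀ {y z} → Active C y → _≺_ C y z → ¬ (end C z ≤ᵒ end C y)
  active-≺⇒¬end≤ wf {z = z} ay y≺z z≤y = ay z (≺⇒≢ y≺z) (inj₁ y≺z , inj₁ (wf z) , z≤y)

  active-≺⇒end< : WellFormed C → ∀ {y z} → Active C y → _≺_ C y z → end C y < end C z
  active-≺⇒end< wf {y} {z} ay y≺z with compare (end C y) (end C z)
  ... | tri< y<z _ _ = y<z
  ... | tri≈ _ y≈z _ = ⊥-elim (active-≺⇒¬end≤ wf ay y≺z (inj₂ (Eq.sym y≈z)))
  ... | tri> _ _ z<y = ⊥-elim (active-≺⇒¬end≤ wf ay y≺z (inj₁ z<y))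

proposition7 : {a ℓ₁ ℓ₂ : Level} (O : StrictTotalOrder a ℓ₁ ℓ₂) (n : ℕ)
    (C : Intervals.Collection O n) →
    Intervals.WellFormed O C → Intervals.DistinctEndpoints O C →
    ∀ i → Intervals.Active O C i →
    ∀ x y z → Intervals.Active O C x → Intervals.Active O C y → Intervals.Active O C z →
    Intervals._≺_ O C x y → Intervals._≺_ O C y z →
    Intervals.LCdecr O C x i → Intervals.LCdecr O C z i → Intervals.LCdecr O C y i
proposition7 O n C wf _ i _ x y z ax ay _ x≺y y≺z x↦i z↦i =
  LCdecr-between-ends x↦i z↦i
    (inj₁ (active-≺⇒end< wf ax x≺y)) (inj₁ (active-≺⇒end< wf ay y≺z))
  where open LCdecrProperties O C
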